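{- Let $\mathcal{F}$ be the class of all finite forests. Then the indeque ratio of $\mathcal{F}$ equals $2/3$, i.e. \[ \lim_{n\to\infty}\frac{\min\{\iota(F): F\in\mathcal{F},\ |V(F)|=n\}}{n}=\frac23 . \]
   Context: For a finite simple graph $G$, a set $S\subseteq V(G)$ is an indeque set if the induced subgraph $G[S]$ is a disjoint union of cliques with no edges between distinct cliques (a "cluster graph"). The indeque number $\iota(G)$ is the maximum size of an indeque set of $G$. For a class $\mathcal{G}$ of graphs, let $\iota(\mathcal{G},n)=\min\{\iota(G):G\in\mathcal{G},\ |V(G)|=n\}$, and the indeque ratio of $\mathcal{G}$ is $\lim_{n\to\infty}\iota(\mathcal{G},n)/n$ (this limit exists for classes closed under disjoint union). -}

module Defs where

open import Data.Nat using (ℕ; suc; _≤_; _<_)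
open import Data.Fin using (Fin)
open import Data.Fin.Subset using (Subset; _∈_; ∣_∣)
open import Data.Bool using (Bool; true; false)
open import Data.List using (List; _∷_; length; _∷ʳ_)
open import Data.List.Relation.Unary.Unique.Propositional using (Unique)
open import Data.List.Relation.Unary.Linked using (Linked)
open import Data.Product using (Σ; ∃; _×_)
open import Relation.Binary.PropositionalEquality using (_≡_; _≢_)
open import Relation.Nullary using (¬_)
open import Function.Bundles using (_⇔_)

record Graph (n : ℕ) : Set where
  field
    adj   : Fin n → Fin n → Bool
    sym   : ∀ u v → adj u v ≡ adj v u
    irref : ∀ v → adj v v ≡ false

open Graph public

Adj : ∀ {n} → Graph n → Fin n → Fin n → Set
Adj G u v = adj G u v ≡ true

HasCycle : ∀ {n} → Graph n → Set
HasCycle G = Σ _ λ v → Σ _ λ ws →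
  (3 ≤ length (v ∷ ws)) × Unique (v ∷ ws) × Linked (Adj G) ((v ∷ ws) ∷ʳ v)

IsForest : ∀ {n} → Graph n → Set
IsForest G = ¬ HasCycle G

-- S is an indeque set: G[S] is a disjoint union of cliques with no edges
-- between distinct cliques, i.e. there is a labelling of vertices by clique
-- such that distinct vertices of S are adjacent iff they lie in the same clique.
IsIndeque : ∀ {n} → Graph n → Subset n → Set
IsIndeque {n} G S = Σ (Fin n → ℕ) λ clique →
  ∀ u v → u ∈ S → v ∈ S → u ≢ v → (Adj G u v ⇔ clique u ≡ clique v)

IsIndequeNumber : ∀ {n} → Graph n → ℕ → Set
IsIndequeNumber {n} G k =
  (Σ (Subset n) λ S → IsIndeque G S × ∣ S ∣ ≡ k) ×
  (∀ S → IsIndeque G S → ∣ S ∣ ≤ k)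

IsMinForestIndeque : ℕ → ℕ → Set
IsMinForestIndeque n m =
  (Σ (Graph n) λ F → IsForest F × IsIndequeNumber F m) ×
  (∀ (F : Graph n) k → IsForest F → IsIndequeNumber F k → m ≤ k)

-- Lower bound: a forest on n vertices has a dissociation set (one inducing maximum degree at
-- most 1, i.e. a disjoint union of K₁'s and K₂'s, hence an indeque set) of at least 2n/3
-- vertices. Inductively remove a small piece and keep at least two thirds of it: an isolated
-- vertex, an isolated edge, or, at a vertex p of degree ≥ 2 with at most one neighbour of
-- degree ≥ 2, two of p's leaves (deleting p too) or one leaf and p (deleting p's other
-- neighbour). Such a p exists because a forest admits no infinite non-backtracking walk.
-- Upper bound: in ⌊n/3⌋ P₃ + (n mod 3) K₁ an indeque set misses a vertex of every P₃, as
-- adjacency is transitive on an indeque set; so ι = ⌈2n/3⌉, and ⌈2n/3⌉/n → 2/3.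
module Submission where

open import Defs hiding (sym)

-- Scoped, so that ℕ's _<_ and the subset size ∣_∣ do not clash with the rational notation below.
module _ where

  open import Data.Nat using (ℕ; zero; suc; _+_; _*_; _∸_; _≤_; _<_; _⊓_; z≤n; s≤s; s≤s⁻¹; anyUpTo?)
  open import Data.Nat.Properties
  open import Data.Nat.Induction using (<-rec)
  open import Data.Bool using (Bool; true; false; _∨_) renaming (_≟_ to _≟ᵇ_)
  open import Data.Bool.Properties using (∨-comm)
  open import Data.Fin using (Fin; toℕ) renaming (zero to fzero; suc to fsuc)
  open import Data.Fin.Properties using (any?; all?; pigeonhole; toℕ-injective)
    renaming (_≟_ to _≟ᶠ_; suc-injective to fsuc-injective)
  open import Data.Fin.Subset using (Subset; _∈_; _∉_; _⊆_; ∣_∣; _∪_; _∩_; _─_; ⁅_⁆; ⊤; Nonempty; inside; outside)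
    renaming (⊥ to ∅)
  open import Data.Fin.Subset.Properties
    using (_∈?_; nonempty?; Empty-unique; ∉⊥; x∈p∪q⁻; x∈p∪q⁺; x∈p∩q⁺; p─q⊆p; p∩q≢∅⇒∣p─q∣<∣p∣;
           x∈⁅x⁆; x∈⁅y⁆⇒x≡y; ∣⁅x⁆∣≡1; ∣p∩q∣≤∣q∣; ∣⊤∣≡n; ∣p∣≤n)
  open import Data.Vec using ([]; _∷_; here; there)
  open import Data.List using ([]; _∷_; applyUpTo; _∷ʳ_)
  open import Data.List.Properties using (length-applyUpTo; applyUpTo-∷ʳ)
  open import Data.List.Relation.Unary.All using ([]; _∷_)
  open import Data.List.Relation.Unary.AllPairs using ([]; _∷_)
  open import Data.List.Relation.Unary.Linked using (Linked; []; [-]; _∷_)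
  open import Data.List.Relation.Unary.Unique.Propositional.Properties using (applyUpTo⁺₁)
  open import Data.Product using (∃; _×_; _,_)
  open import Data.Sum using (_⊎_; inj₁; inj₂; map₁)
  open import Data.Empty using (⊥; ⊥-elim)
  open import Function using (_∘_; _∘′_)
  open import Function.Bundles using (mk⇔; Equivalence)
  open import Relation.Binary.PropositionalEquality
  open import Relation.Nullary using (¬_; Dec; yes; no)
  open import Relation.Nullary.Decidable using (_×-dec_; _→-dec_; ¬?; map′)
  open import Relation.Unary using (Pred; Decidable; U)
  open import Level using (0ℓ)

  least-witness : ∀ {P : Pred ℕ 0ℓ} → Decidable P → ∀ {n} → P n →
                  ∃ λ j → P j × (∀ {k} → k < j → ¬ P k)
  least-witness {P} P? {n} = <-rec (λ n → P n → Least) least n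
    where
    Least = ∃ λ j → P j × (∀ {k} → k < j → ¬ P k)

    least : ∀ n → (∀ {m} → m < n → P m → Least) → P n → Least
    least n earlier pn with anyUpTo? P? n
    ... | yes (m , m<n , pm) = earlier m<n pm
    ... | no none            = n , pn , λ k<n pk → none (_ , k<n , pk)

  x∈p─q⇒x∉q : ∀ {n} (p q : Subset n) {x} → x ∈ p ─ q → x ∉ q
  x∈p─q⇒x∉q (_ ∷ p) (inside  ∷ q) () here
  x∈p─q⇒x∉q (_ ∷ p) (_       ∷ q) (there x∈) (there x∈q) = x∈p─q⇒x∉q p q x∈ x∈q

  ∣p∣≡∣p∩q∣+∣p─q∣ : ∀ {n} (p q : Subset n) → ∣ p ∣ ≡ ∣ p ∩ q ∣ + ∣ p ─ q ∣
  ∣p∣≡∣p∩q∣+∣p─q∣ [] [] = refl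
  ∣p∣≡∣p∩q∣+∣p─q∣ (inside  ∷ p) (inside  ∷ q) = cong suc (∣p∣≡∣p∩q∣+∣p─q∣ p q)
  ∣p∣≡∣p∩q∣+∣p─q∣ (inside  ∷ p) (outside ∷ q) = trans (cong suc (∣p∣≡∣p∩q∣+∣p─q∣ p q)) (sym (+-suc _ _))
  ∣p∣≡∣p∩q∣+∣p─q∣ (outside ∷ p) (inside  ∷ q) = ∣p∣≡∣p∩q∣+∣p─q∣ p q
  ∣p∣≡∣p∩q∣+∣p─q∣ (outside ∷ p) (outside ∷ q) = ∣p∣≡∣p∩q∣+∣p─q∣ p q

  ∣p∪q∣≤∣p∣+∣q∣ : ∀ {n} (p q : Subset n) → ∣ p ∪ q ∣ ≤ ∣ p ∣ + ∣ q ∣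
  ∣p∪q∣≤∣p∣+∣q∣ [] [] = z≤n
  ∣p∪q∣≤∣p∣+∣q∣ (inside  ∷ p) (inside  ∷ q) = s≤s (≤-trans (∣p∪q∣≤∣p∣+∣q∣ p q) (≤-trans (n≤1+n _) (≤-reflexive (sym (+-suc _ _)))))
  ∣p∪q∣≤∣p∣+∣q∣ (inside  ∷ p) (outside ∷ q) = s≤s (∣p∪q∣≤∣p∣+∣q∣ p q)
  ∣p∪q∣≤∣p∣+∣q∣ (outside ∷ p) (inside  ∷ q) = ≤-trans (s≤s (∣p∪q∣≤∣p∣+∣q∣ p q)) (≤-reflexive (sym (+-suc _ _)))
  ∣p∪q∣≤∣p∣+∣q∣ (outside ∷ p) (outside ∷ q) = ∣p∪q∣≤∣p∣+∣q∣ p q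

  ∣p∪q∣≡∣p∣+∣q∣ : ∀ {n} (p q : Subset n) → (∀ {x} → x ∈ p → x ∉ q) → ∣ p ∪ q ∣ ≡ ∣ p ∣ + ∣ q ∣
  ∣p∪q∣≡∣p∣+∣q∣ [] [] _ = refl
  ∣p∪q∣≡∣p∣+∣q∣ (inside  ∷ p) (inside  ∷ q) disj = ⊥-elim (disj here here)
  ∣p∪q∣≡∣p∣+∣q∣ (inside  ∷ p) (outside ∷ q) disj = cong suc (∣p∪q∣≡∣p∣+∣q∣ p q (λ x∈p x∈q → disj (there x∈p) (there x∈q)))
  ∣p∪q∣≡∣p∣+∣q∣ (outside ∷ p) (inside  ∷ q) disj =
    trans (cong suc (∣p∪q∣≡∣p∣+∣q∣ p q (λ x∈p x∈q → disj (there x∈p) (there x∈q)))) (sym (+-suc _ _))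
  ∣p∪q∣≡∣p∣+∣q∣ (outside ∷ p) (outside ∷ q) disj = ∣p∪q∣≡∣p∣+∣q∣ p q (λ x∈p x∈q → disj (there x∈p) (there x∈q))

  linked-applyUpTo : ∀ {A : Set} {R : A → A → Set} (f : ℕ → A) → (∀ k → R (f k) (f (suc k))) →
                     ∀ m → Linked R (applyUpTo f m)
  linked-applyUpTo f step zero          = []
  linked-applyUpTo f step (suc zero)    = [-]
  linked-applyUpTo f step (suc (suc m)) = step 0 ∷ linked-applyUpTo (f ∘ suc) (step ∘ suc) (suc m)

  2*m≤3*m : ∀ m → 2 * m ≤ 3 * m
  2*m≤3*m m = *-monoˡ-≤ m (n≤1+n 2)

  module _ {n : ℕ} (G : Graph n) where

    infix 4 _~_ _~?_

    _~_ : Fin n → Fin n → Set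
    _~_ = Adj G

    _~?_ : ∀ u v → Dec (u ~ v)
    u ~? v = adj G u v ≟ᵇ true

    ~-sym : ∀ {u v} → u ~ v → v ~ u
    ~-sym {u} {v} u~v = trans (Graph.sym G v u) u~v

    ~-irrefl : ∀ {u v} → u ~ v → u ≢ v
    ~-irrefl {u} u~u refl with trans (sym u~u) (irref G u)
    ... | ()

    Deg≤1 : Pred (Fin n) 0ℓ → Fin n → Set
    Deg≤1 B p = ∀ {q q'} → B q → B q' → p ~ q → p ~ q' → q ≡ q'

    deg≤1? : ∀ {B} → Decidable B → Decidable (Deg≤1 B)
    deg≤1? B? p = map′ (λ deg {q} {q'} → deg q q') (λ deg q q' → deg)
      (all? λ q → all? λ q' → B? q →-dec B? q' →-dec p ~? q →-dec p ~? q' →-dec q ≟ᶠ q')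

    other-neighbour : ∀ {B} → Decidable B → ∀ {p} → ¬ Deg≤1 B p →
                      ∀ q → ∃ λ q' → B q' × p ~ q' × q' ≢ q
    other-neighbour {B} B? {p} ¬deg q with any? (λ q' → B? q' ×-dec p ~? q' ×-dec ¬? (q' ≟ᶠ q))
    ... | yes found = found
    ... | no none   = ⊥-elim (¬deg λ q₁∈B q₂∈B p~q₁ p~q₂ → trans (is-q q₁∈B p~q₁) (sym (is-q q₂∈B p~q₂)))
      where
      is-q : ∀ {q'} → B q' → p ~ q' → q' ≡ q
      is-q {q'} q'∈B p~q' with q' ≟ᶠ q
      ... | yes q'≡q = q'≡q
      ... | no q'≢q  = ⊥-elim (none (q' , q'∈B , p~q' , q'≢q))

    IsDissociation : Subset n → Set
    IsDissociation S = ∀ {u} → u ∈ S → Deg≤1 (_∈ S) u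

    ~-TransitiveOn : Subset n → Set
    ~-TransitiveOn S = ∀ {u v w} → u ∈ S → v ∈ S → w ∈ S → u ≢ w → u ~ v → v ~ w → u ~ w

    indeque⇒~-transitiveOn : ∀ {S} → IsIndeque G S → ~-TransitiveOn S
    indeque⇒~-transitiveOn (_ , spec) u∈S v∈S w∈S u≢w u~v v~w =
      Equivalence.from (spec _ _ u∈S w∈S u≢w)
        (trans (Equivalence.to (spec _ _ u∈S v∈S (~-irrefl u~v)) u~v)
               (Equivalence.to (spec _ _ v∈S w∈S (~-irrefl v~w)) v~w))

    module Labelling {S : Subset n} (diss : IsDissociation S) where

      partner? : ∀ u → Dec (∃ λ v → v ∈ S × u ~ v)
      partner? u = any? λ v → v ∈? S ×-dec u ~? v

      -- The two ends of an edge of G[S] share the smaller of their indices.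
      label : Fin n → ℕ
      label u with partner? u
      ... | yes (v , _) = toℕ u ⊓ toℕ v
      ... | no _        = toℕ u

      label-edge : ∀ {u v} → u ∈ S → v ∈ S → u ~ v → label u ≡ toℕ u ⊓ toℕ v
      label-edge {u} u∈S v∈S u~v with partner? u
      ... | yes (w , w∈S , u~w) = cong (λ x → toℕ u ⊓ toℕ x) (diss u∈S w∈S v∈S u~w u~v)
      ... | no none             = ⊥-elim (none (_ , v∈S , u~v))

      label-cases : ∀ u → label u ≡ toℕ u ⊎ ∃ λ v → v ∈ S × u ~ v × label u ≡ toℕ v
      label-cases u with partner? u
      ... | no _ = inj₁ refl
      ... | yes (v , v∈S , u~v) with ⊓-sel (toℕ u) (toℕ v)
      ...   | inj₁ is-u = inj₁ is-u
      ...   | inj₂ is-v = inj₂ (v , v∈S , u~v , is-v)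

      ~⇒label-≡ : ∀ {u v} → u ∈ S → v ∈ S → u ~ v → label u ≡ label v
      ~⇒label-≡ {u} {v} u∈S v∈S u~v = begin
        label u          ≡⟨ label-edge u∈S v∈S u~v ⟩
        toℕ u ⊓ toℕ v    ≡⟨ ⊓-comm (toℕ u) (toℕ v) ⟩
        toℕ v ⊓ toℕ u    ≡⟨ label-edge v∈S u∈S (~-sym u~v) ⟨
        label v          ∎
        where open ≡-Reasoning

      same-label : ∀ {u v} {x y : Fin n} → label u ≡ label v → label u ≡ toℕ x → label v ≡ toℕ y → x ≡ y
      same-label eq lx ly = toℕ-injective (trans (sym lx) (trans eq ly))

      label-≡⇒~ : ∀ {u v} → u ∈ S → v ∈ S → u ≢ v → label u ≡ label v → u ~ v
      label-≡⇒~ {u} {v} u∈S v∈S u≢v eq with label-cases u | label-cases v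
      ... | inj₁ lu | inj₁ lv = ⊥-elim (u≢v (same-label eq lu lv))
      ... | inj₂ (_ , _ , u~u' , lu) | inj₁ lv = subst (u ~_) (same-label eq lu lv) u~u'
      ... | inj₁ lu | inj₂ (_ , _ , v~v' , lv) = ~-sym (subst (v ~_) (sym (same-label eq lu lv)) v~v')
      ... | inj₂ (_ , u'∈S , u~u' , lu) | inj₂ (_ , _ , v~v' , lv) =
        ⊥-elim (u≢v (diss u'∈S u∈S v∈S (~-sym u~u') (subst (_~ v) (sym (same-label eq lu lv)) (~-sym v~v'))))

    dissociation⇒indeque : ∀ {S} → IsDissociation S → IsIndeque G S
    dissociation⇒indeque diss = label , λ u v u∈S v∈S u≢v → mk⇔ (~⇒label-≡ u∈S v∈S) (label-≡⇒~ u∈S v∈S u≢v)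
      where open Labelling diss

    closedWalk⇒cycle : ∀ (v : ℕ → Fin n) d → 3 ≤ d → (∀ k → v k ~ v (suc k)) →
                       (∀ {i j} → i < j → j < d → v i ≢ v j) → v d ≡ v 0 → HasCycle G
    closedWalk⇒cycle v (suc d) 3≤d step distinct closed =
      v 0 , applyUpTo (v ∘ suc) d ,
      subst (3 ≤_) (sym (length-applyUpTo v (suc d))) 3≤d ,
      applyUpTo⁺₁ v (suc d) distinct ,
      subst (λ x → Linked _~_ (applyUpTo v (suc d) ∷ʳ x)) closed
        (subst (Linked _~_) (sym (applyUpTo-∷ʳ v (suc d))) (linked-applyUpTo v step (suc (suc d))))

    module _ (star : ∀ {u v} → u ~ v → Deg≤1 U u ⊎ Deg≤1 U v) where

      star-backtracks : ∀ {a b c d} → a ~ b → b ~ c → c ~ d → a ≢ c → d ≡ b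
      star-backtracks a~b b~c c~d a≢c with star b~c
      ... | inj₁ b-deg≤1 = ⊥-elim (a≢c (b-deg≤1 _ _ (~-sym a~b) b~c))
      ... | inj₂ c-deg≤1 = c-deg≤1 _ _ c~d (~-sym b~c)

      starForest⇒forest : IsForest G
      starForest⇒forest (v , [] , s≤s () , _)
      starForest⇒forest (v , _ ∷ [] , s≤s (s≤s ()) , _)
      starForest⇒forest (v , w₁ ∷ w₂ ∷ [] , _ , (v≢w₁ ∷ v≢w₂ ∷ []) ∷ _ , v~w₁ ∷ w₁~w₂ ∷ w₂~v ∷ _) =
        v≢w₁ (star-backtracks v~w₁ w₁~w₂ w₂~v v≢w₂)
      starForest⇒forest (v , w₁ ∷ w₂ ∷ r ∷ _ , _ , (_ ∷ v≢w₂ ∷ _) ∷ (_ ∷ w₁≢r ∷ _) ∷ _ , v~w₁ ∷ w₁~w₂ ∷ w₂~r ∷ _) =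
        w₁≢r (sym (star-backtracks v~w₁ w₁~w₂ w₂~r v≢w₂))

    module _ (forest : IsForest G) where

      forest-¬nonBacktrackingWalk : (w : ℕ → Fin n) → (∀ k → w k ~ w (suc k)) →
                                    (∀ k → w (suc (suc k)) ≢ w k) → ⊥
      forest-¬nonBacktrackingWalk w step turn with pigeonhole (n<1+n n) (w ∘ toℕ)
      ... | a , _ , a<b , wa≡wb = loop-is-cycle (least-witness returns? (toℕ a , a<b , wa≡wb))
        where
        Returns : ℕ → Set
        Returns j = ∃ λ i → i < j × w i ≡ w j

        returns? : Decidable Returns
        returns? j = anyUpTo? (λ i → w i ≟ᶠ w j) j

        loop-is-cycle : (∃ λ j → Returns j × (∀ {k} → k < j → ¬ Returns k)) → ⊥
        loop-is-cycle (j , (i , i<j , wi≡wj) , no-earlier-return) = closes (j ∸ i) (m∸n+n≡m (<⇒≤ i<j))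
          where
          -- Minimality of j makes w injective on [i, j), so the loop from w i back to itself is a cycle.
          closes : ∀ d → d + i ≡ j → ⊥
          closes 0 i≡j = <⇒≢ i<j i≡j
          closes 1 1+i≡j = ~-irrefl (step i) (trans wi≡wj (sym (cong w 1+i≡j)))
          closes 2 2+i≡j = turn i (trans (cong w 2+i≡j) (sym wi≡wj))
          closes (suc (suc (suc e))) d+i≡j =
            forest (closedWalk⇒cycle (λ k → w (k + i)) (3 + e) (s≤s (s≤s (s≤s z≤n)))
                                     (λ k → step (k + i)) distinct (trans (cong w d+i≡j) (sym wi≡wj)))
            where
            distinct : ∀ {l l'} → l < l' → l' < 3 + e → w (l + i) ≢ w (l' + i)
            distinct {l} {l'} l<l' l'<d eq =
              no-earlier-return (subst (l' + i <_) d+i≡j (+-monoˡ-< i l'<d)) (l + i , +-monoˡ-< i l<l' , eq)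

      -- If no vertex of B had at most one neighbour in B, one could walk inside B forever without turning back.
      forest-∃deg≤1 : ∀ {B} → Decidable B → ∀ {x} → B x → ∃ λ p → B p × Deg≤1 B p
      forest-∃deg≤1 {B} B? {x} x∈B with any? (λ p → B? p ×-dec deg≤1? B? p)
      ... | yes found = found
      ... | no none   = ⊥-elim (forest-¬nonBacktrackingWalk (tail ∘ arc) (tail~head ∘ arc) (turns ∘ arc))
        where
        branching : ∀ {p} → B p → ¬ Deg≤1 B p
        branching p∈B deg = none (_ , p∈B , deg)

        record Arc : Set where
          field
            tail head : Fin n
            head∈B    : B head
            tail~head : tail ~ head
        open Arc

        start : Arc
        start = let q , q∈B , x~q , _ = other-neighbour B? (branching x∈B) x in
                record { tail = x ; head = q ; head∈B = q∈B ; tail~head = x~q }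

        turn : (a : Arc) → ∃ λ q → B q × head a ~ q × q ≢ tail a
        turn a = other-neighbour B? (branching (head∈B a)) (tail a)

        next : Arc → Arc
        next a = let q , q∈B , head~q , _ = turn a in
                 record { tail = head a ; head = q ; head∈B = q∈B ; tail~head = head~q }

        turns : ∀ a → head (next a) ≢ tail a
        turns a = let _ , _ , _ , q≢tail = turn a in q≢tail

        arc : ℕ → Arc
        arc zero    = start
        arc (suc k) = next (arc k)

    pair : Fin n → Fin n → Subset n
    pair a b = ⁅ a ⁆ ∪ ⁅ b ⁆

    ∈-pair⁻ : ∀ {a b x} → x ∈ pair a b → x ≡ a ⊎ x ≡ b
    ∈-pair⁻ {a} {b} x∈ with x∈p∪q⁻ ⁅ a ⁆ ⁅ b ⁆ x∈
    ... | inj₁ x∈a = inj₁ (x∈⁅y⁆⇒x≡y a x∈a)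
    ... | inj₂ x∈b = inj₂ (x∈⁅y⁆⇒x≡y b x∈b)

    ∈-pair⁺ : ∀ {a b x} → x ≡ a ⊎ x ≡ b → x ∈ pair a b
    ∈-pair⁺ {a} (inj₁ refl) = x∈p∪q⁺ (inj₁ (x∈⁅x⁆ a))
    ∈-pair⁺ {b = b} (inj₂ refl) = x∈p∪q⁺ (inj₂ (x∈⁅x⁆ b))

    ∣pair∣ : ∀ {a b} → a ≢ b → ∣ pair a b ∣ ≡ 2
    ∣pair∣ {a} {b} a≢b = begin
      ∣ pair a b ∣            ≡⟨ ∣p∪q∣≡∣p∣+∣q∣ ⁅ a ⁆ ⁅ b ⁆ disjoint ⟩
      ∣ ⁅ a ⁆ ∣ + ∣ ⁅ b ⁆ ∣   ≡⟨ cong₂ _+_ (∣⁅x⁆∣≡1 a) (∣⁅x⁆∣≡1 b) ⟩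
      2                       ∎
      where
      open ≡-Reasoning
      disjoint : ∀ {x} → x ∈ ⁅ a ⁆ → x ∉ ⁅ b ⁆
      disjoint x∈a x∈b = a≢b (trans (sym (x∈⁅y⁆⇒x≡y a x∈a)) (x∈⁅y⁆⇒x≡y b x∈b))

    singleton-dissociation : ∀ a → IsDissociation ⁅ a ⁆
    singleton-dissociation a _ q∈ q'∈ _ _ = trans (x∈⁅y⁆⇒x≡y a q∈) (sym (x∈⁅y⁆⇒x≡y a q'∈))

    -- Both neighbours q, q' of u inside {a, b} differ from u, so they are the same vertex.
    pair-dissociation : ∀ a b → IsDissociation (pair a b)
    pair-dissociation a b u∈ q∈ q'∈ u~q u~q' with ∈-pair⁻ u∈ | ∈-pair⁻ q∈ | ∈-pair⁻ q'∈
    ... | _         | inj₁ refl | inj₁ refl = refl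
    ... | _         | inj₂ refl | inj₂ refl = refl
    ... | inj₁ refl | inj₁ refl | inj₂ refl = ⊥-elim (~-irrefl u~q refl)
    ... | inj₂ refl | inj₁ refl | inj₂ refl = ⊥-elim (~-irrefl u~q' refl)
    ... | inj₁ refl | inj₂ refl | inj₁ refl = ⊥-elim (~-irrefl u~q' refl)
    ... | inj₂ refl | inj₂ refl | inj₁ refl = ⊥-elim (~-irrefl u~q refl)

    record LargeDissociation (A : Subset n) : Set where
      constructor largeDissociation
      field
        set          : Subset n
        set⊆A        : set ⊆ A
        dissociation : IsDissociation set
        large        : 2 * ∣ A ∣ ≤ 3 * ∣ set ∣

    -- The induction deletes region from A and adds core to the dissociation set found for what remains.
    record Piece (A : Subset n) : Set where
      field
        core region       : Subset n
        core⊆A            : core ⊆ A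
        core⊆region       : core ⊆ region
        core-nonempty     : Nonempty core
        core-dissociation : IsDissociation core
        region-closed     : ∀ {t x} → t ∈ core → x ∈ A → t ~ x → x ∈ region
        region-small      : 2 * ∣ region ∣ ≤ 3 * ∣ core ∣

    module _ {A : Subset n} where

      empty-largeDissociation : ¬ Nonempty A → LargeDissociation A
      empty-largeDissociation empty = largeDissociation ∅ (λ x∈⊥ → ⊥-elim (∉⊥ x∈⊥)) (λ x∈⊥ → ⊥-elim (∉⊥ x∈⊥))
        (subst (λ B → 2 * ∣ B ∣ ≤ 3 * ∣ ∅ {n} ∣) (sym (Empty-unique empty)) (2*m≤3*m ∣ ∅ {n} ∣))

      extend : (P : Piece A) → LargeDissociation (A ─ Piece.region P) → LargeDissociation A
      extend P (largeDissociation S S⊆A─R dissS large) =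
        largeDissociation (S ∪ T) S∪T⊆A dissS∪T size
        where
        open Piece P renaming (core to T; region to R)

        S⊆A : S ⊆ A
        S⊆A x∈S = p─q⊆p A R (S⊆A─R x∈S)

        S∩R≡∅ : ∀ {x} → x ∈ S → x ∉ R
        S∩R≡∅ x∈S = x∈p─q⇒x∉q A R (S⊆A─R x∈S)

        S∪T⊆A : S ∪ T ⊆ A
        S∪T⊆A x∈ with x∈p∪q⁻ S T x∈
        ... | inj₁ x∈S = S⊆A x∈S
        ... | inj₂ x∈T = core⊆A x∈T

        T↛S : ∀ {t x} → t ∈ T → x ∈ S → ¬ t ~ x
        T↛S t∈T x∈S t~x = S∩R≡∅ x∈S (region-closed t∈T (S⊆A x∈S) t~x)

        dissS∪T : IsDissociation (S ∪ T)
        dissS∪T u∈ q∈ q'∈ u~q u~q' with x∈p∪q⁻ S T u∈ | x∈p∪q⁻ S T q∈ | x∈p∪q⁻ S T q'∈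
        ... | inj₁ u∈S | inj₁ q∈S | inj₁ q'∈S = dissS u∈S q∈S q'∈S u~q u~q'
        ... | inj₂ u∈T | inj₂ q∈T | inj₂ q'∈T = core-dissociation u∈T q∈T q'∈T u~q u~q'
        ... | inj₂ u∈T | inj₁ q∈S | _         = ⊥-elim (T↛S u∈T q∈S u~q)
        ... | inj₂ u∈T | _        | inj₁ q'∈S = ⊥-elim (T↛S u∈T q'∈S u~q')
        ... | inj₁ u∈S | inj₂ q∈T | _         = ⊥-elim (T↛S q∈T u∈S (~-sym u~q))
        ... | inj₁ u∈S | _        | inj₂ q'∈T = ⊥-elim (T↛S q'∈T u∈S (~-sym u~q'))

        size : 2 * ∣ A ∣ ≤ 3 * ∣ S ∪ T ∣
        size = begin
          2 * ∣ A ∣                         ≡⟨ cong (2 *_) (∣p∣≡∣p∩q∣+∣p─q∣ A R) ⟩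
          2 * (∣ A ∩ R ∣ + ∣ A ─ R ∣)       ≡⟨ *-distribˡ-+ 2 ∣ A ∩ R ∣ ∣ A ─ R ∣ ⟩
          2 * ∣ A ∩ R ∣ + 2 * ∣ A ─ R ∣     ≤⟨ +-mono-≤ (*-monoʳ-≤ 2 (∣p∩q∣≤∣q∣ A R)) large ⟩
          2 * ∣ R ∣ + 3 * ∣ S ∣             ≤⟨ +-monoˡ-≤ (3 * ∣ S ∣) region-small ⟩
          3 * ∣ T ∣ + 3 * ∣ S ∣             ≡⟨ *-distribˡ-+ 3 ∣ T ∣ ∣ S ∣ ⟨
          3 * (∣ T ∣ + ∣ S ∣)               ≡⟨ cong (3 *_) (+-comm ∣ T ∣ ∣ S ∣) ⟩
          3 * (∣ S ∣ + ∣ T ∣)               ≡⟨ cong (3 *_) (∣p∪q∣≡∣p∣+∣q∣ S T (λ x∈S x∈T → S∩R≡∅ x∈S (core⊆region x∈T))) ⟨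
          3 * ∣ S ∪ T ∣                     ∎
          where open ≤-Reasoning

      singletonPiece : ∀ {u} → u ∈ A → (∀ {x} → x ∈ A → ¬ u ~ x) → Piece A
      singletonPiece {u} u∈A isolated = record
        { core = ⁅ u ⁆ ; region = ⁅ u ⁆
        ; core⊆A = λ x∈u → subst (_∈ A) (sym (x∈⁅y⁆⇒x≡y u x∈u)) u∈A
        ; core⊆region = λ x∈u → x∈u
        ; core-nonempty = u , x∈⁅x⁆ u
        ; core-dissociation = singleton-dissociation u
        ; region-closed = λ t∈u x∈A t~x → ⊥-elim (isolated x∈A (subst (_~ _) (x∈⁅y⁆⇒x≡y u t∈u) t~x))
        ; region-small = 2*m≤3*m ∣ ⁅ u ⁆ ∣
        }

      pairPiece : ∀ {a b c} → a ∈ A → b ∈ A → a ≢ b →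
                  (∀ {x} → x ∈ A → a ~ x → x ≡ b ⊎ x ≡ c) →
                  (∀ {x} → x ∈ A → b ~ x → x ≡ a ⊎ x ≡ c) → Piece A
      pairPiece {a} {b} {c} a∈A b∈A a≢b a-nbrs b-nbrs = record
        { core = pair a b ; region = pair a b ∪ ⁅ c ⁆
        ; core⊆A = core⊆A
        ; core⊆region = x∈p∪q⁺ ∘′ inj₁
        ; core-nonempty = a , ∈-pair⁺ (inj₁ refl)
        ; core-dissociation = pair-dissociation a b
        ; region-closed = region-closed
        ; region-small = size
        }
        where
        core⊆A : pair a b ⊆ A
        core⊆A x∈ with ∈-pair⁻ x∈
        ... | inj₁ refl = a∈A
        ... | inj₂ refl = b∈A

        ∈region : ∀ {x} → x ∈ pair a b ⊎ x ≡ c → x ∈ pair a b ∪ ⁅ c ⁆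
        ∈region (inj₁ x∈ab)  = x∈p∪q⁺ (inj₁ x∈ab)
        ∈region (inj₂ refl) = x∈p∪q⁺ (inj₂ (x∈⁅x⁆ c))

        region-closed : ∀ {t x} → t ∈ pair a b → x ∈ A → t ~ x → x ∈ pair a b ∪ ⁅ c ⁆
        region-closed t∈ x∈A t~x with ∈-pair⁻ t∈
        ... | inj₁ refl = ∈region (map₁ (∈-pair⁺ ∘′ inj₂) (a-nbrs x∈A t~x))
        ... | inj₂ refl = ∈region (map₁ (∈-pair⁺ ∘′ inj₁) (b-nbrs x∈A t~x))

        size : 2 * ∣ pair a b ∪ ⁅ c ⁆ ∣ ≤ 3 * ∣ pair a b ∣
        size = begin
          2 * ∣ pair a b ∪ ⁅ c ⁆ ∣          ≤⟨ *-monoʳ-≤ 2 (∣p∪q∣≤∣p∣+∣q∣ (pair a b) ⁅ c ⁆) ⟩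
          2 * (∣ pair a b ∣ + ∣ ⁅ c ⁆ ∣)    ≡⟨ cong₂ (λ s t → 2 * (s + t)) (∣pair∣ a≢b) (∣⁅x⁆∣≡1 c) ⟩
          6                                 ≡⟨ cong (3 *_) (∣pair∣ a≢b) ⟨
          3 * ∣ pair a b ∣                  ∎
          where open ≤-Reasoning

      Leaf Branch : Fin n → Set
      Leaf u   = u ∈ A × Deg≤1 (_∈ A) u
      Branch u = u ∈ A × ¬ Deg≤1 (_∈ A) u

      branch? : Decidable Branch
      branch? u = u ∈? A ×-dec ¬? (deg≤1? (_∈? A) u)

      leaf-or-branch : ∀ {u} → u ∈ A → Leaf u ⊎ Branch u
      leaf-or-branch {u} u∈A with deg≤1? (_∈? A) u
      ... | yes deg = inj₁ (u∈A , deg)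
      ... | no ¬deg = inj₂ (u∈A , ¬deg)

      TwoLeaves : Fin n → Set
      TwoLeaves p = ∃ λ v → ∃ λ w → v ≢ w × Leaf v × Leaf w × p ~ v × p ~ w

      twoLeaves? : Decidable TwoLeaves
      twoLeaves? p = any? λ v → any? λ w → ¬? (v ≟ᶠ w) ×-dec (v ∈? A ×-dec deg≤1? (_∈? A) v) ×-dec
                                            (w ∈? A ×-dec deg≤1? (_∈? A) w) ×-dec p ~? v ×-dec p ~? w

      twoLeavesPiece : ∀ {p} → p ∈ A → TwoLeaves p → Piece A
      twoLeavesPiece {p} p∈A (v , w , v≢w , (v∈A , v-deg) , (w∈A , w-deg) , p~v , p~w) =
        pairPiece {c = p} v∈A w∈A v≢w (λ x∈A v~x → inj₂ (v-deg x∈A p∈A v~x (~-sym p~v)))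
                              (λ x∈A w~x → inj₂ (w-deg x∈A p∈A w~x (~-sym p~w)))

      leafBranchPiece : ∀ {p v g} → p ∈ A → Deg≤1 Branch p → ¬ TwoLeaves p →
                        Leaf v → Branch g → p ~ v → p ~ g → Piece A
      leafBranchPiece {p} {v} {g} p∈A deg ¬two (v∈A , v-deg) g-branch p~v p~g =
        pairPiece {c = g} v∈A p∈A (~-irrefl (~-sym p~v)) (λ x∈A v~x → inj₁ (v-deg x∈A p∈A v~x (~-sym p~v))) p-nbrs
        where
        p-nbrs : ∀ {x} → x ∈ A → p ~ x → x ≡ v ⊎ x ≡ g
        p-nbrs {x} x∈A p~x with leaf-or-branch x∈A | x ≟ᶠ v
        ... | _              | yes x≡v = inj₁ x≡v
        ... | inj₁ x-leaf    | no x≢v  = ⊥-elim (¬two (x , v , x≢v , x-leaf , (v∈A , v-deg) , p~x , p~v))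
        ... | inj₂ x-branch  | no _    = inj₂ (deg x-branch g-branch p~x p~g)

      -- A branch vertex p with at most one branch neighbour has two neighbours, at least one a leaf.
      fringePiece : ∀ {p} → Branch p → Deg≤1 Branch p → Piece A
      fringePiece {p} (p∈A , ¬deg) deg with twoLeaves? p
      ... | yes two = twoLeavesPiece p∈A two
      ... | no ¬two with other-neighbour (_∈? A) ¬deg p
      ...   | q , q∈A , p~q , _ with other-neighbour (_∈? A) ¬deg q
      ...     | q' , q'∈A , p~q' , q'≢q with leaf-or-branch q∈A | leaf-or-branch q'∈A
      ...       | inj₁ q-leaf   | inj₁ q'-leaf   = ⊥-elim (¬two (q' , q , q'≢q , q'-leaf , q-leaf , p~q' , p~q))
      ...       | inj₁ q-leaf   | inj₂ q'-branch = leafBranchPiece p∈A deg ¬two q-leaf q'-branch p~q p~q'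
      ...       | inj₂ q-branch | inj₁ q'-leaf   = leafBranchPiece p∈A deg ¬two q'-leaf q-branch p~q' p~q
      ...       | inj₂ q-branch | inj₂ q'-branch = ⊥-elim (q'≢q (deg q'-branch q-branch p~q' p~q))

      branchPiece : IsForest G → ∀ {b} → Branch b → Piece A
      branchPiece forest b-branch with forest-∃deg≤1 forest branch? b-branch
      ... | p , p-branch , deg = fringePiece p-branch deg

      ∃-piece : IsForest G → ∀ {x} → x ∈ A → Piece A
      ∃-piece forest {x} x∈A with any? (λ y → y ∈? A ×-dec x ~? y)
      ... | no isolated = singletonPiece x∈A (λ y∈A x~y → isolated (_ , y∈A , x~y))
      ... | yes (y , y∈A , x~y) with leaf-or-branch x∈A | leaf-or-branch y∈A
      ...   | inj₂ x-branch    | _                = branchPiece forest x-branch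
      ...   | inj₁ _           | inj₂ y-branch    = branchPiece forest y-branch
      ...   | inj₁ (_ , x-deg) | inj₁ (_ , y-deg) =
        pairPiece {c = x} x∈A y∈A (~-irrefl x~y) (λ z∈A x~z → inj₁ (x-deg z∈A y∈A x~z x~y))
                                                 (λ z∈A y~z → inj₁ (y-deg z∈A x∈A y~z (~-sym x~y)))

    forest-largeDissociation : IsForest G → ∀ A → LargeDissociation A
    forest-largeDissociation forest A = go (suc ∣ A ∣) A ≤-refl
      where
      go : ∀ k A → ∣ A ∣ < k → LargeDissociation A
      go (suc k) A |A|<1+k with nonempty? A
      ... | no empty      = empty-largeDissociation empty
      ... | yes (x , x∈A) = extend P (go k (A ─ region) (<-≤-trans shrinks (s≤s⁻¹ |A|<1+k)))
        where
        P : Piece A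
        P = ∃-piece forest x∈A
        open Piece P

        shrinks : ∣ A ─ region ∣ < ∣ A ∣
        shrinks = let t , t∈core = core-nonempty in
                  p∩q≢∅⇒∣p─q∣<∣p∣ A region (t , x∈p∩q⁺ (core⊆A t∈core , core⊆region t∈core))

    forest-largeIndeque : IsForest G → ∃ λ S → IsIndeque G S × 2 * n ≤ 3 * ∣ S ∣
    forest-largeIndeque forest =
      set , dissociation⇒indeque dissociation , subst (λ m → 2 * m ≤ 3 * ∣ set ∣) (∣⊤∣≡n n) large
      where open LargeDissociation (forest-largeDissociation forest ⊤)

  -- a ↦ b: in the block {3q, 3q + 1, 3q + 2}, the leaf a ∈ {3q, 3q + 1} hangs on the centre b = 3q + 2.
  infix 4 _↦_

  data _↦_ : ℕ → ℕ → Set where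
    leaf₀      : 0 ↦ 2
    leaf₁      : 1 ↦ 2
    next-block : ∀ {a b} → a ↦ b → 3 + a ↦ 3 + b

  hangsOn : ℕ → ℕ → Bool
  hangsOn 0 2 = true
  hangsOn 1 2 = true
  hangsOn (suc (suc (suc a))) (suc (suc (suc b))) = hangsOn a b
  hangsOn _ _ = false

  hangsOn⇒↦ : ∀ a b → hangsOn a b ≡ true → a ↦ b
  hangsOn⇒↦ 0 2 _ = leaf₀
  hangsOn⇒↦ 1 2 _ = leaf₁
  hangsOn⇒↦ (suc (suc (suc a))) (suc (suc (suc b))) h = next-block (hangsOn⇒↦ a b h)
  hangsOn⇒↦ 0 0 ()
  hangsOn⇒↦ 0 1 ()
  hangsOn⇒↦ 0 (suc (suc (suc b))) ()
  hangsOn⇒↦ 1 0 ()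
  hangsOn⇒↦ 1 1 ()
  hangsOn⇒↦ 1 (suc (suc (suc b))) ()
  hangsOn⇒↦ 2 _ ()
  hangsOn⇒↦ (suc (suc (suc a))) 0 ()
  hangsOn⇒↦ (suc (suc (suc a))) 1 ()
  hangsOn⇒↦ (suc (suc (suc a))) 2 ()

  hangsOn-irrefl : ∀ a → hangsOn a a ≡ false
  hangsOn-irrefl 0 = refl
  hangsOn-irrefl 1 = refl
  hangsOn-irrefl 2 = refl
  hangsOn-irrefl (suc (suc (suc a))) = hangsOn-irrefl a

  centre : ℕ → ℕ
  centre (suc (suc (suc a))) = 3 + centre a
  centre _ = 2

  ↦-centre : ∀ {a b} → a ↦ b → b ≡ centre a
  ↦-centre leaf₀ = refl
  ↦-centre leaf₁ = refl
  ↦-centre (next-block a↦b) = cong (3 +_) (↦-centre a↦b)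

  ↦-centre-fixed : ∀ {a b} → a ↦ b → b ≡ centre b
  ↦-centre-fixed leaf₀ = refl
  ↦-centre-fixed leaf₁ = refl
  ↦-centre-fixed (next-block a↦b) = cong (3 +_) (↦-centre-fixed a↦b)

  ↦-leaf : ∀ {a b} → a ↦ b → a ≢ centre a
  ↦-leaf leaf₀ ()
  ↦-leaf leaf₁ ()
  ↦-leaf (next-block a↦b) eq = ↦-leaf a↦b (suc-injective (suc-injective (suc-injective eq)))

  -- ⌊n/3⌋ P₃ + (n mod 3) K₁
  P₃s : ∀ n → Graph n
  P₃s n = record
    { adj   = λ u v → hangsOn (toℕ u) (toℕ v) ∨ hangsOn (toℕ v) (toℕ u)
    ; sym   = λ u v → ∨-comm (hangsOn (toℕ u) (toℕ v)) _
    ; irref = λ v → cong₂ _∨_ (hangsOn-irrefl (toℕ v)) (hangsOn-irrefl (toℕ v))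
    }

  module _ {n : ℕ} where

    P₃s-edge : ∀ {u v : Fin n} → Adj (P₃s n) u v → toℕ u ↦ toℕ v ⊎ toℕ v ↦ toℕ u
    P₃s-edge {u} {v} u~v with hangsOn (toℕ u) (toℕ v) in uv
    ... | true  = inj₁ (hangsOn⇒↦ _ _ uv)
    ... | false = inj₂ (hangsOn⇒↦ _ _ u~v)

    P₃s-leaf-deg≤1 : ∀ {u v : Fin n} → toℕ u ↦ toℕ v → Deg≤1 (P₃s n) U u
    P₃s-leaf-deg≤1 {u} u↦v _ _ u~q u~q' = toℕ-injective (trans (to-centre u~q) (sym (to-centre u~q')))
      where
      to-centre : ∀ {x} → Adj (P₃s n) u x → toℕ x ≡ centre (toℕ u)
      to-centre u~x with P₃s-edge u~x
      ... | inj₁ u↦x = ↦-centre u↦x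
      ... | inj₂ x↦u = ⊥-elim (↦-leaf u↦v (↦-centre-fixed x↦u))

    P₃s-forest : IsForest (P₃s n)
    P₃s-forest = starForest⇒forest (P₃s n) star
      where
      star : ∀ {u v} → Adj (P₃s n) u v → Deg≤1 (P₃s n) U u ⊎ Deg≤1 (P₃s n) U v
      star u~v with P₃s-edge u~v
      ... | inj₁ u↦v = inj₁ (P₃s-leaf-deg≤1 u↦v)
      ... | inj₂ v↦u = inj₂ (P₃s-leaf-deg≤1 v↦u)

  ⌈2/3·_⌉ : ℕ → ℕ
  ⌈2/3· suc (suc (suc m)) ⌉ = 2 + ⌈2/3· m ⌉
  ⌈2/3· m ⌉ = m

  2*n≤3*⌈2/3·n⌉ : ∀ n → 2 * n ≤ 3 * ⌈2/3· n ⌉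
  2*n≤3*⌈2/3·n⌉ 0 = z≤n
  2*n≤3*⌈2/3·n⌉ 1 = s≤s (s≤s z≤n)
  2*n≤3*⌈2/3·n⌉ 2 = s≤s (s≤s (s≤s (s≤s z≤n)))
  2*n≤3*⌈2/3·n⌉ (suc (suc (suc m))) = begin
    2 * (3 + m)          ≡⟨ *-distribˡ-+ 2 3 m ⟩
    6 + 2 * m            ≤⟨ +-monoʳ-≤ 6 (2*n≤3*⌈2/3·n⌉ m) ⟩
    6 + 3 * ⌈2/3· m ⌉    ≡⟨ *-distribˡ-+ 3 2 ⌈2/3· m ⌉ ⟨
    3 * (2 + ⌈2/3· m ⌉)  ∎
    where open ≤-Reasoning

  3*⌈2/3·n⌉≤2*n+2 : ∀ n → 3 * ⌈2/3· n ⌉ ≤ 2 * n + 2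
  3*⌈2/3·n⌉≤2*n+2 0 = z≤n
  3*⌈2/3·n⌉≤2*n+2 1 = s≤s (s≤s (s≤s z≤n))
  3*⌈2/3·n⌉≤2*n+2 2 = s≤s (s≤s (s≤s (s≤s (s≤s (s≤s z≤n)))))
  3*⌈2/3·n⌉≤2*n+2 (suc (suc (suc m))) = begin
    3 * (2 + ⌈2/3· m ⌉)  ≡⟨ *-distribˡ-+ 3 2 ⌈2/3· m ⌉ ⟩
    6 + 3 * ⌈2/3· m ⌉    ≤⟨ +-monoʳ-≤ 6 (3*⌈2/3·n⌉≤2*n+2 m) ⟩
    6 + (2 * m + 2)      ≡⟨ cong (_+ 2) (*-distribˡ-+ 2 3 m) ⟨
    2 * (3 + m) + 2      ∎
    where open ≤-Reasoning

  ⌈2/3·n⌉-least : ∀ {n k} → 2 * n ≤ 3 * k → ⌈2/3· n ⌉ ≤ k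
  ⌈2/3·n⌉-least {n} {k} 2n≤3k = s≤s⁻¹ (*-cancelˡ-< 3 ⌈2/3· n ⌉ (suc k) (begin-strict
    3 * ⌈2/3· n ⌉   ≤⟨ 3*⌈2/3·n⌉≤2*n+2 n ⟩
    2 * n + 2       ≤⟨ +-monoˡ-≤ 2 2n≤3k ⟩
    3 * k + 2       <⟨ +-monoʳ-< (3 * k) (n<1+n 2) ⟩
    3 * k + 3       ≡⟨ +-comm (3 * k) 3 ⟩
    3 + 3 * k       ≡⟨ *-suc 3 k ⟨
    3 * suc k       ∎))
    where open ≤-Reasoning

  leaves : ∀ n → Subset n
  leaves (suc (suc (suc m))) = inside ∷ inside ∷ outside ∷ leaves m
  leaves n = ⊤

  ∣leaves∣ : ∀ n → ∣ leaves n ∣ ≡ ⌈2/3· n ⌉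
  ∣leaves∣ 0 = refl
  ∣leaves∣ 1 = refl
  ∣leaves∣ 2 = refl
  ∣leaves∣ (suc (suc (suc m))) = cong (2 +_) (∣leaves∣ m)

  leaves-noncentre : ∀ n {x : Fin n} → x ∈ leaves n → toℕ x ≢ centre (toℕ x)
  leaves-noncentre 1 {fzero} _ ()
  leaves-noncentre 2 {fzero} _ ()
  leaves-noncentre 2 {fsuc fzero} _ ()
  leaves-noncentre (suc (suc (suc m))) {fzero} _ ()
  leaves-noncentre (suc (suc (suc m))) {fsuc fzero} _ ()
  leaves-noncentre (suc (suc (suc m))) {fsuc (fsuc fzero)} (there (there ()))
  leaves-noncentre (suc (suc (suc m))) {fsuc (fsuc (fsuc x))} (there (there (there x∈))) eq =
    leaves-noncentre m x∈ (suc-injective (suc-injective (suc-injective eq)))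

  leaves-indeque : ∀ n → IsIndeque (P₃s n) (leaves n)
  leaves-indeque n = toℕ , λ u v u∈ v∈ u≢v →
    mk⇔ (λ u~v → ⊥-elim (no-edge u∈ v∈ u~v)) (λ eq → ⊥-elim (u≢v (toℕ-injective eq)))
    where
    no-edge : ∀ {u v} → u ∈ leaves n → v ∈ leaves n → ¬ Adj (P₃s n) u v
    no-edge u∈ v∈ u~v with P₃s-edge u~v
    ... | inj₁ u↦v = leaves-noncentre n v∈ (↦-centre-fixed u↦v)
    ... | inj₂ v↦u = leaves-noncentre n u∈ (↦-centre-fixed v↦u)

  -- Adjacency is transitive on S, so S misses a vertex of every path 3q — 3q + 2 — 3q + 1.
  ~-transitiveOn-bound : ∀ n S → ~-TransitiveOn (P₃s n) S → ∣ S ∣ ≤ ⌈2/3· n ⌉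
  ~-transitiveOn-bound 0 [] _ = z≤n
  ~-transitiveOn-bound 1 S _ = ∣p∣≤n S
  ~-transitiveOn-bound 2 S _ = ∣p∣≤n S
  ~-transitiveOn-bound (suc (suc (suc m))) (s₀ ∷ s₁ ∷ s₂ ∷ S) trans-on =
    block s₀ s₁ s₂ trans-on (~-transitiveOn-bound m S λ u∈ v∈ w∈ u≢w →
      trans-on (there³ u∈) (there³ v∈) (there³ w∈) (λ eq → u≢w (fsuc-injective (fsuc-injective (fsuc-injective eq)))))
    where
    there³ : ∀ {x} → x ∈ S → fsuc (fsuc (fsuc x)) ∈ s₀ ∷ s₁ ∷ s₂ ∷ S
    there³ x∈ = there (there (there x∈))

    block : ∀ s₀ s₁ s₂ → ~-TransitiveOn (P₃s (3 + m)) (s₀ ∷ s₁ ∷ s₂ ∷ S) → ∣ S ∣ ≤ ⌈2/3· m ⌉ →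
            ∣ s₀ ∷ s₁ ∷ s₂ ∷ S ∣ ≤ 2 + ⌈2/3· m ⌉
    block inside inside inside trans-on _ with trans-on here (there (there here)) (there here) (λ ()) refl refl
    ... | ()
    block inside  inside  outside _ bound = s≤s (s≤s bound)
    block inside  outside inside  _ bound = s≤s (s≤s bound)
    block outside inside  inside  _ bound = s≤s (s≤s bound)
    block inside  outside outside _ bound = s≤s (m≤n⇒m≤1+n bound)
    block outside inside  outside _ bound = s≤s (m≤n⇒m≤1+n bound)
    block outside outside inside  _ bound = s≤s (m≤n⇒m≤1+n bound)
    block outside outside outside _ bound = m≤n⇒m≤1+n (m≤n⇒m≤1+n bound)

  ι-P₃s : ∀ n → IsIndequeNumber (P₃s n) ⌈2/3· n ⌉
  ι-P₃s n = (leaves n , leaves-indeque n , ∣leaves∣ n) ,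
            λ S indeque → ~-transitiveOn-bound n S (indeque⇒~-transitiveOn (P₃s n) indeque)

  minForestIndeque : ∀ n → IsMinForestIndeque n ⌈2/3· n ⌉
  minForestIndeque n = (P₃s n , P₃s-forest , ι-P₃s n) , λ F k forest (_ , maximum) →
    let S , indeque , large = forest-largeIndeque F forest
    in ⌈2/3·n⌉-least {n} (≤-trans large (*-monoʳ-≤ 3 (maximum S indeque)))

open import Data.Nat using (ℕ; zero; suc; _+_; _*_; _∸_; _≤_; NonZero)
import Data.Nat as ℕ
import Data.Nat.Properties as ℕ
open import Data.Nat.Coprimality using (Coprime)
open import Data.Integer using (+_; -[1+_]; +<+)
import Data.Integer as ℤ
import Data.Integer.Properties as ℤ
open import Data.Rational using (ℚ; mkℚ; 0ℚ; _/_; _-_; -_; ∣_∣; _<_; *<*; toℚᵘ)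
open import Data.Rational.Properties using (toℚᵘ-cancel-<; toℚᵘ-homo-∣-∣; toℚᵘ-homo-+; toℚᵘ-homo‿-; toℚᵘ-fromℚᵘ)
import Data.Rational.Unnormalised as ℚᵘ
import Data.Rational.Unnormalised.Properties as ℚᵘ
open import Data.Product using (Σ; _×_; _,_)
open import Relation.Binary.PropositionalEquality using (_≡_; sym; trans; cong; subst; subst₂)

-- |m/n − 2/3| = (3m − 2n)/3n ≤ 2/3n < 1/n ≤ 1/(d + 1) ≤ (p + 1)/(d + 1) for n = k + 1 ≥ d + 1.
∣m/n-2/3∣<ε : ∀ p d .(c : Coprime (suc p) (suc d)) k m → suc d ≤ suc k →
              2 * suc k ≤ 3 * m → 3 * m ≤ 2 * suc k + 2 →
              ∣ (+ m / suc k) - (+ 2 / 3) ∣ < mkℚ (+ suc p) d c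
∣m/n-2/3∣<ε p d c k m d≤k lower upper = toℚᵘ-cancel-< (ℚᵘ.<-respˡ-≃ (ℚᵘ.≃-sym as-unnormalised) bound)
  where
  q r : ℚ
  q = + m / suc k
  r = + 2 / 3
  qᵘ rᵘ : ℚᵘ.ℚᵘ
  qᵘ = ℚᵘ.mkℚᵘ (+ m) k
  rᵘ = ℚᵘ.mkℚᵘ (+ 2) 2

  as-unnormalised : toℚᵘ ∣ q - r ∣ ℚᵘ.≃ ℚᵘ.∣ qᵘ ℚᵘ.- rᵘ ∣
  as-unnormalised = ℚᵘ.≃-trans (toℚᵘ-homo-∣-∣ (q - r)) (ℚᵘ.∣-∣-cong (ℚᵘ.≃-trans (toℚᵘ-homo-+ q (- r))
    (ℚᵘ.+-cong (toℚᵘ-fromℚᵘ qᵘ) (ℚᵘ.≃-trans (toℚᵘ-homo‿- r) (ℚᵘ.-‿cong (toℚᵘ-fromℚᵘ rᵘ))))))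

  δ : ℤ.ℤ
  δ = + m ℤ.* + 3 ℤ.+ -[1+ 1 ] ℤ.* + suc k

  δ≡3m-2n : δ ≡ + (m * 3 ∸ 2 * suc k)
  δ≡3m-2n = trans (cong (ℤ._+ _) (ℤ.+◃n≡+n (m * 3)))
              (trans (ℤ.m-n≡m⊖n (m * 3) (2 * suc k)) (ℤ.⊖-≥ (subst (2 * suc k ≤_) (ℕ.*-comm 3 m) lower)))

  ∣δ∣≤2 : ℤ.∣ δ ∣ ≤ 2
  ∣δ∣≤2 = subst (_≤ 2) (sym (cong ℤ.∣_∣ δ≡3m-2n))
            (ℕ.m≤n+o⇒m∸n≤o (m * 3) (2 * suc k) (subst (_≤ 2 * suc k + 2) (ℕ.*-comm 3 m) upper))

  cross : ℤ.∣ δ ∣ * suc d ℕ.< suc p * (suc k * 3)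
  cross = begin-strict
    ℤ.∣ δ ∣ * suc d      ≤⟨ ℕ.*-monoˡ-≤ (suc d) ∣δ∣≤2 ⟩
    2 * suc d            ≤⟨ ℕ.*-monoʳ-≤ 2 d≤k ⟩
    2 * suc k            <⟨ ℕ.*-monoˡ-< (suc k) (ℕ.n<1+n 2) ⟩
    3 * suc k            ≡⟨ ℕ.*-comm 3 (suc k) ⟩
    suc k * 3            ≤⟨ ℕ.m≤n*m (suc k * 3) (suc p) ⟩
    suc p * (suc k * 3)  ∎
    where open ℕ.≤-Reasoning

  bound : ℚᵘ.∣ qᵘ ℚᵘ.- rᵘ ∣ ℚᵘ.< ℚᵘ.mkℚᵘ (+ suc p) d
  bound = ℚᵘ.*<* (subst₂ ℤ._<_ (sym (ℤ.+◃n≡+n _)) (sym (ℤ.+◃n≡+n _)) (+<+ cross))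

mainTheorem1 : ∀ (ε : ℚ) → 0ℚ < ε → Σ ℕ λ N → ∀ (n : ℕ) .{{_ : NonZero n}} → N ≤ n →
    Σ ℕ λ m → IsMinForestIndeque n m × ∣ (+ m / n) - (+ 2 / 3) ∣ < ε
mainTheorem1 (mkℚ (+ zero) _ _) (*<* (+<+ ()))
mainTheorem1 (mkℚ -[1+ _ ] _ _) (*<* ())
mainTheorem1 (mkℚ (+ suc p) d c) _ = suc d , λ where
  (suc k) d≤k → ⌈2/3· suc k ⌉ , minForestIndeque (suc k) ,
                ∣m/n-2/3∣<ε p d c k ⌈2/3· suc k ⌉ d≤k (2*n≤3*⌈2/3·n⌉ (suc k)) (3*⌈2/3·n⌉≤2*n+2 (suc k))
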